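{- Let $G=(V,E)$ be a directed acyclic graph with exactly one source and exactly one sink, and suppose $G$ contains a superbubble $\langle s,t\rangle$ with vertex set $U$. Let $\textit{ordD}$ be a topological ordering of $G$ obtained by the procedure TopologicalSort described in the context. Then: (1) for every $x\in U\setminus\{s,t\}$, $\textit{ordD}[s]<\textit{ordD}[x]<\textit{ordD}[t]$; (2) for every $y\in V\setminus U$, either $\textit{ordD}[y]<\textit{ordD}[s]$ or $\textit{ordD}[y]>\textit{ordD}[t]$.
   Context: A path passes through a vertex $x$ if $x$ is an internal vertex of it; every vertex is reachable from itself. For distinct vertices $s,t$, $\langle s,t\rangle$ is a superbubble if: (reachability) $t$ is reachable from $s$; (matching) the set of vertices reachable from $s$ by a path not passing through $t$ equals the set of vertices from which $t$ is reachable by a path not passing through $s$ — this common set is $U$, the vertex set of the superbubble (it contains $s,t$); (acyclicity) the subgraph induced by $U$ is acyclic; (minimality) no vertex of $U$ other than $t$ forms with $s$ a pair $\langle s,\cdot\rangle$ satisfying the three previous conditions. Procedure TopologicalSort, with $n=|V|$: set $\textit{order}:=n$, mark all vertices unvisited, and call Visit(source), where Visit($v$): mark $v$ visited; for each out-neighbour $w$ of $v$ (in arbitrary order) that is unvisited, call Visit($w$); then set $\textit{ordD}[v]:=\textit{order}$ and decrement $\textit{order}$. -}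

module Defs where

open import Data.Nat using (ℕ; zero; suc; _∸_; _<_)
open import Data.Fin using (Fin; _≟_)
open import Data.List using (List; []; _∷_)
open import Data.List.Membership.Propositional using (_∈_)
open import Data.List.Relation.Unary.All using (All)
open import Data.Bool using (Bool; true; false; if_then_else_)
open import Data.Product using (Σ; ∃; _×_; _,_)
open import Data.Sum using (_⊎_)
open import Data.Empty using (⊥)
open import Relation.Nullary using (¬_; does)
open import Relation.Binary.PropositionalEquality using (_≡_; _≢_)

-- The order of each list is the (arbitrary) order in which TopologicalSort
-- scans out-neighbours; quantifying over all such lists captures "arbitrary order".
record Graph : Set where
  field
    n   : ℕ
    adj : Fin n → List (Fin n)

module _ (G : Graph) where
  open Graph G

  Edge : Fin n → Fin n → Set
  Edge u w = w ∈ adj u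

  data Walk : Fin n → Fin n → Set where
    []  : ∀ {u} → Walk u u
    _∷_ : ∀ {u w v} → Edge u w → Walk w v → Walk u v

  internals : ∀ {u v} → Walk u v → List (Fin n)
  internals [] = []
  internals (_ ∷ []) = []
  internals (_∷_ {w = w} _ (e ∷ p)) = w ∷ internals (e ∷ p)

  vertices : ∀ {u v} → Walk u v → List (Fin n)
  vertices {u} [] = u ∷ []
  vertices {u} (_ ∷ p) = u ∷ vertices p

  ReachAvoid : Fin n → Fin n → Fin n → Set
  ReachAvoid x u v = Σ (Walk u v) λ p → ¬ (x ∈ internals p)

  Reach : Fin n → Fin n → Set
  Reach u v = Walk u v

  Acyclic : Set
  Acyclic = ∀ {u w} (e : Edge u w) (p : Walk w u) → ⊥

  IsSource IsSink : Fin n → Set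
  IsSource v = ∀ u → ¬ Edge u v
  IsSink v = ∀ w → ¬ Edge v w

  InU : Fin n → Fin n → Fin n → Set
  InU s t v = ReachAvoid t s v

  SuperbubbleCandidate : Fin n → Fin n → Set
  SuperbubbleCandidate s t =
    s ≢ t
    × Reach s t
    × (∀ v → (ReachAvoid t s v → ReachAvoid s v t) × (ReachAvoid s v t → ReachAvoid t s v))
    × (∀ {u w} (e : Edge u w) (p : Walk w u) → All (InU s t) (vertices (e ∷ p)) → ⊥)

  Superbubble : Fin n → Fin n → Set
  Superbubble s t =
    SuperbubbleCandidate s t
    × (∀ u → InU s t u → u ≢ t → ¬ SuperbubbleCandidate s u)

  record State : Set where
    field
      visited : Fin n → Bool
      order   : ℕ
      ordD    : Fin n → ℕ

  mark : Fin n → State → State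
  mark v st = record st { visited = λ x → if does (x ≟ v) then true else State.visited st x }

  assign : Fin n → State → State
  assign v st = record st
    { ordD = λ x → if does (x ≟ v) then State.order st else State.ordD st x
    ; order = State.order st ∸ 1 }

  mutual
    data Visit : State → Fin n → State → Set where
      visit : ∀ {st v st'} →
              VisitAll (mark v st) (adj v) st' →
              Visit st v (assign v st')

    data VisitAll : State → List (Fin n) → State → Set where
      done : ∀ {st} → VisitAll st [] st
      skip : ∀ {st w ws st'} → State.visited st w ≡ true →
             VisitAll st ws st' → VisitAll st (w ∷ ws) st'
      call : ∀ {st w ws st₁ st'} → State.visited st w ≡ false →
             Visit st w st₁ → VisitAll st₁ ws st' → VisitAll st (w ∷ ws) st'

  initState : State
  initState = record { visited = λ _ → false ; order = n ; ordD = λ _ → 0 }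

  TopologicalSort : Fin n → (Fin n → ℕ) → Set
  TopologicalSort src ordD =
    Σ State λ st → Visit initState src st × State.ordD st ≡ ordD

-- The numbers are handed out in decreasing order as the calls of Visit finish. An invariant of
-- the run shows that the finished vertices are closed under out-edges, numbered injectively and
-- increasingly along edges; at the end every vertex is finished, since every vertex of an
-- acyclic graph is reachable from its unique source. Every predecessor of a vertex of U ∖ {s}
-- lies in U ∖ {s} or is s, so the search enters U ∖ {s} only after s. Hence t is finished
-- during the call Visit(s) and gets a smaller number than every vertex finished before that
-- call; so a vertex numbered strictly between s and t was finished during Visit(s) and is
-- reachable from s. Part (1) follows from the paths s ↝ x ↝ t. For (2), a vertex y ∉ U
-- numbered between s and t would be reached from s by a path through t, forcing
-- ordD[t] < ordD[y].

module Submission where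

open import Defs
open import Data.Nat using (ℕ; zero; suc; _<_; _≤_; _+_; s≤s)
open import Data.Nat.Properties
  using (≤-refl; ≤-trans; <-trans; <-irrefl; <-asym; <-cmp; ≤-<-trans; <⇒≱; ≰⇒>; _≤?_;
         +-suc; +-identityʳ; +-cancelʳ-≤; m∸n≤m)
open import Data.Fin as Fin using (Fin; _≟_)
open import Data.Fin.Properties using (pigeonhole; any?)
open import Data.List using (List; []; _∷_; length; lookup)
open import Data.List.Membership.Propositional using (_∈_; _∉_)
open import Data.List.Membership.Propositional.Properties using (∈-lookup)
import Data.List.Membership.DecPropositional as DecMembership
open import Data.List.Relation.Unary.Any using (here; there)
import Data.List.Relation.Unary.All as All
open import Data.List.Relation.Unary.All.Properties using (¬Any⇒All¬)
open import Data.List.Relation.Unary.AllPairs using ([]; _∷_)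
open import Data.List.Relation.Unary.Unique.Propositional using (Unique)
open import Data.List.Relation.Binary.Subset.Propositional using (_⊆_)
open import Data.Bool using (true; false)
open import Data.Product using (∃; _×_; _,_; proj₁; proj₂)
open import Data.Sum using (_⊎_; inj₁; inj₂)
open import Data.Empty using (⊥; ⊥-elim)
open import Function using (_∘_)
open import Relation.Nullary using (¬_; yes; no)
open import Relation.Binary.Definitions using (tri<; tri≈; tri>)
open import Relation.Binary.PropositionalEquality using (_≡_; _≢_; refl; sym; trans; subst; subst₂)

Unique-lookup-injective : ∀ {A : Set} {xs : List A} → Unique xs →
                          ∀ {i j} → i Fin.< j → lookup xs i ≢ lookup xs j
Unique-lookup-injective (x≢xs ∷ _)   {Fin.zero}  {Fin.suc j} _         = All.lookup x≢xs (∈-lookup j)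
Unique-lookup-injective (_ ∷ unique) {Fin.suc i} {Fin.suc j} (s≤s i<j) = Unique-lookup-injective unique i<j

Unique⇒length≤ : ∀ {n} {xs : List (Fin n)} → Unique xs → length xs ≤ n
Unique⇒length≤ {n} {xs} unique with length xs ≤? n
... | yes ≤n = ≤n
... | no ≰n with pigeonhole (≰⇒> ≰n) (lookup xs)
...   | i , j , i<j , eq = ⊥-elim (Unique-lookup-injective unique i<j eq)

module Walks (G : Graph) where
  open Graph G
  open DecMembership (_≟_ {n}) using (_∈?_)

  _▷_ : ∀ {u v w} → Walk G u v → Edge G v w → Walk G u w
  [] ▷ e = e ∷ []
  (e′ ∷ p) ▷ e = e′ ∷ (p ▷ e)

  walk-to-vertex : ∀ {u v x} (p : Walk G u v) → x ∈ vertices G p → Walk G u x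
  walk-to-vertex []      (here refl) = []
  walk-to-vertex (e ∷ p) (here refl) = []
  walk-to-vertex (e ∷ p) (there x∈p) = e ∷ walk-to-vertex p x∈p

  walk-from-internal : ∀ {u v x} (p : Walk G u v) → x ∈ internals G p →
                       ∃ λ w → Edge G x w × Walk G w v
  walk-from-internal (e ∷ (e′ ∷ p)) (here refl) = _ , e′ , p
  walk-from-internal (e ∷ (e′ ∷ p)) (there x∈p) = walk-from-internal (e′ ∷ p) x∈p

  ∉-internals-∷ : ∀ {u w v x} (e : Edge G u w) (p : Walk G w v) →
                  x ≢ w → x ∉ internals G p → x ∉ internals G (e ∷ p)
  ∉-internals-∷ e []      _   _   ()
  ∉-internals-∷ e (_ ∷ _) x≢w _   (here x≡w)  = x≢w x≡w
  ∉-internals-∷ e (_ ∷ _) _   x∉p (there x∈p) = x∉p x∈p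

  walk-to-source : ∀ {u v} → IsSource G v → Walk G u v → u ≡ v
  walk-to-source source []      = refl
  walk-to-source source (e ∷ p) = ⊥-elim (no-step-into source e p)
    where
      no-step-into : ∀ {u w v} → IsSource G v → Edge G u w → Walk G w v → ⊥
      no-step-into source e []       = source _ e
      no-step-into source _ (e ∷ p) = no-step-into source e p

  module _ (acyclic : Acyclic G) where

    acyclic-walk-unique : ∀ {u v} (p : Walk G u v) → Unique (vertices G p)
    acyclic-walk-unique []      = All.[] ∷ []
    acyclic-walk-unique (e ∷ p) =
      ¬Any⇒All¬ _ (λ u∈p → acyclic e (walk-to-vertex p u∈p)) ∷ acyclic-walk-unique p

    -- Extend the walk backwards while its first vertex has an in-neighbour; acyclic walks have
    -- at most n vertices, so n extensions suffice.
    walk-from-source : ∀ k {u y} (p : Walk G u y) → n < length (vertices G p) + k →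
                       ∃ λ r → IsSource G r × Walk G r y
    walk-from-source zero p bound =
      ⊥-elim (<⇒≱ (subst (n <_) (+-identityʳ _) bound) (Unique⇒length≤ (acyclic-walk-unique p)))
    walk-from-source (suc k) {u} p bound with any? (λ r → u ∈? adj r)
    ... | no no-in-edge = u , (λ r e → no-in-edge (r , e)) , p
    ... | yes (r , e)   = walk-from-source k (e ∷ p) (subst (n <_) (+-suc _ k) bound)

    unique-source-reaches : ∀ src → (∀ v → IsSource G v → v ≡ src) → ∀ y → Walk G src y
    unique-source-reaches src unique y with walk-from-source n {y} [] ≤-refl
    ... | r , source , p = subst (λ r → Walk G r y) (unique r source) p

record SeparatingNumbering (G : Graph) (s t : Fin (Graph.n G)) (f : Fin (Graph.n G) → ℕ) : Set where
  field
    edge-increasing   : ∀ {u w} → Edge G u w → f u < f w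
    injective         : ∀ {x y} → f x ≡ f y → x ≡ y
    between-reachable : ∀ {y} → f s < f y → f y < f t → Walk G s y

  step-walk-increasing : ∀ {u w x} → Edge G u w → Walk G w x → f u < f x
  step-walk-increasing e []       = edge-increasing e
  step-walk-increasing e (e′ ∷ p) = <-trans (edge-increasing e) (step-walk-increasing e′ p)

  walk-increasing : ∀ {u w} → u ≢ w → Walk G u w → f u < f w
  walk-increasing u≢u []      = ⊥-elim (u≢u refl)
  walk-increasing _   (e ∷ p) = step-walk-increasing e p

module Superbubbles (G : Graph) (acyclic : Acyclic G) {s t : Fin (Graph.n G)}
                    (candidate : SuperbubbleCandidate G s t) where
  open Graph G
  open Walks G
  open DecMembership (_≟_ {n}) using (_∈?_)

  s≢t : s ≢ t
  s≢t = proj₁ candidate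

  s↝t : Walk G s t
  s↝t = proj₁ (proj₂ candidate)

  matching : ∀ v → (InU G s t v → ReachAvoid G s v t) × (ReachAvoid G s v t → InU G s t v)
  matching = proj₁ (proj₂ (proj₂ candidate))

  s∈U : InU G s t s
  s∈U = [] , λ ()

  t∈U : InU G s t t
  t∈U with proj₁ (matching s) s∈U
  ... | p , _ with t ∈? internals G p
  ...   | no t∉p = p , t∉p
  ...   | yes t∈p with walk-from-internal p t∈p
  ...     | _ , e , q = ⊥-elim (acyclic e q)

  InU∖s : Fin n → Set
  InU∖s x = InU G s t x × x ≢ s

  t∈U∖s : InU∖s t
  t∈U∖s = t∈U , λ t≡s → s≢t (sym t≡s)

  -- By matching, v ∈ U reaches t avoiding s; prefixing the edge u → v keeps s avoided when u ≢ s.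
  U∖s-entered-via-s : ∀ {u v} → Edge G u v → InU∖s v → InU∖s u ⊎ u ≡ s
  U∖s-entered-via-s {u} {v} e (v∈U , v≢s) with u ≟ s
  ... | yes u≡s = inj₂ u≡s
  ... | no u≢s with proj₁ (matching v) v∈U
  ...   | p , s∉p =
    inj₁ (proj₂ (matching u) (e ∷ p , ∉-internals-∷ e p (λ s≡v → v≢s (sym s≡v)) s∉p) , u≢s)

  source∉U∖s : ∀ {r} → IsSource G r → ¬ InU∖s r
  source∉U∖s source ((s↝r , _) , r≢s) = r≢s (sym (walk-to-source source s↝r))

  module _ {f : Fin n → ℕ} (N : SeparatingNumbering G s t f) where
    open SeparatingNumbering N

    interior-between : ∀ x → InU G s t x → x ≢ s → x ≢ t → (f s < f x) × (f x < f t)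
    interior-between x x∈U x≢s x≢t with proj₁ (matching x) x∈U
    ... | x↝t , _ =
      walk-increasing (λ s≡x → x≢s (sym s≡x)) (proj₁ x∈U) , walk-increasing x≢t x↝t

    exterior-outside : ∀ y → ¬ InU G s t y → (f y < f s) ⊎ (f t < f y)
    exterior-outside y y∉U with <-cmp (f y) (f s)
    ... | tri< y<s _ _ = inj₁ y<s
    ... | tri≈ _ y≡s _ = ⊥-elim (y∉U (subst (InU G s t) (injective (sym y≡s)) s∈U))
    ... | tri> _ _ s<y with <-cmp (f t) (f y)
    ...   | tri< t<y _ _ = inj₂ t<y
    ...   | tri≈ _ t≡y _ = ⊥-elim (y∉U (subst (InU G s t) (injective t≡y) t∈U))
    ...   | tri> _ _ y<t with between-reachable s<y y<t
    ...     | s↝y with t ∈? internals G s↝y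
    ...       | no t∉p = ⊥-elim (y∉U (s↝y , t∉p))
    ...       | yes t∈p with walk-from-internal s↝y t∈p
    ...         | _ , e , w↝y = ⊥-elim (<-asym y<t (step-walk-increasing e w↝y))

module DepthFirstSearch (G : Graph) where
  open Graph G
  open State
  open Walks G
  open DecMembership (_≟_ {n}) using (_∈?_)

  record Visited (st : State G) (x : Fin n) : Set where
    constructor visited✓
    field is-visited : visited st x ≡ true

  unvisited⇒¬Visited : ∀ {st x} → visited st x ≡ false → ¬ Visited st x
  unvisited⇒¬Visited unvisited (visited✓ isVisited) with trans (sym isVisited) unvisited
  ... | ()

  mark-visits : ∀ v st → Visited (mark G v st) v
  mark-visits v st = visited✓ marked
    where
      marked : visited (mark G v st) v ≡ true
      marked with v ≟ v
      ... | yes _   = refl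
      ... | no v≢v = ⊥-elim (v≢v refl)

  mark-preserves : ∀ {v st x} → Visited st x → Visited (mark G v st) x
  mark-preserves {v} {st} {x} (visited✓ isVisited) = visited✓ still-visited
    where
      still-visited : visited (mark G v st) x ≡ true
      still-visited with x ≟ v
      ... | yes _ = refl
      ... | no _  = isVisited

  mark-visited⁻ : ∀ {v st x} → Visited (mark G v st) x → x ≡ v ⊎ Visited st x
  mark-visited⁻ {v} {st} {x} (visited✓ isVisited) with x ≟ v
  ... | yes x≡v = inj₁ x≡v
  ... | no _    = inj₂ (visited✓ isVisited)

  assign-Visited : ∀ {v st x} → Visited st x → Visited (assign G v st) x
  assign-Visited (visited✓ isVisited) = visited✓ isVisited

  assign-Visited⁻ : ∀ {v st x} → Visited (assign G v st) x → Visited st x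
  assign-Visited⁻ (visited✓ isVisited) = visited✓ isVisited

  assign-ordD-self : ∀ v st → ordD (assign G v st) v ≡ order st
  assign-ordD-self v st with v ≟ v
  ... | yes _   = refl
  ... | no v≢v = ⊥-elim (v≢v refl)

  assign-ordD-other : ∀ {v st x} → x ≢ v → ordD (assign G v st) x ≡ ordD st x
  assign-ordD-other {v} {x = x} x≢v with x ≟ v
  ... | yes x≡v = ⊥-elim (x≢v x≡v)
  ... | no _    = refl

  -- P is a region that the search can only enter through s; in the theorem it is U ∖ {s}.
  module Region (acyclic : Acyclic G) (s t : Fin n) (P : Fin n → Set)
                (entered-via-s : ∀ {u v} → Edge G u v → P v → P u ⊎ u ≡ s)
                (Pt : P t) (s≢t : s ≢ t) (s↝t : Walk G s t) where

    record Invariant (stack finished : List (Fin n)) (st : State G) : Set where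
      field
        order+finished≡n            : order st + length finished ≡ n
        finished-unique             : Unique finished
        finished-visited            : ∀ {x} → x ∈ finished → Visited st x
        order<ordD                  : ∀ {x} → x ∈ finished → order st < ordD st x
        visited-finished-or-stacked : ∀ {x} → Visited st x → x ∈ finished ⊎ x ∈ stack
        stack-not-finished          : ∀ {x} → x ∈ stack → x ∉ finished
        stack-visited               : ∀ {x} → x ∈ stack → Visited st x
        finished-edge               : ∀ {u w} → u ∈ finished → Edge G u w →
                                      w ∈ finished × ordD st u < ordD st w
        ordD-injective              : ∀ {x y} → x ∈ finished → y ∈ finished →
                                      ordD st x ≡ ordD st y → x ≡ y
        region-after-s              : ∀ {x} → P x → Visited st x → Visited st s
        between-reachable           : s ∈ finished → ∀ {y} → y ∈ finished →
                                      ordD st s < ordD st y → ordD st y < ordD st t → Walk G s y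

    module _ {stack finished st} (I : Invariant stack finished st) where
      open Invariant I

      finished-closed : ∀ {u w} → u ∈ finished → Walk G u w → w ∈ finished
      finished-closed u∈finished []      = u∈finished
      finished-closed u∈finished (e ∷ p) = finished-closed (proj₁ (finished-edge u∈finished e)) p

    initial-invariant : Invariant [] [] (initState G)
    initial-invariant = record
      { order+finished≡n = +-identityʳ n ; finished-unique = [] ; finished-visited = λ ()
      ; order<ordD = λ () ; visited-finished-or-stacked = λ () ; stack-not-finished = λ ()
      ; stack-visited = λ () ; finished-edge = λ () ; ordD-injective = λ ()
      ; region-after-s = λ _ () ; between-reachable = λ () }

    start-invariant : ∀ {stack finished st v} → Invariant stack finished st → visited st v ≡ false →
                      (P v → Visited st s) → Invariant (v ∷ stack) finished (mark G v st)
    start-invariant {stack} {finished} {st} {v} I unvisited guard = record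
      { order+finished≡n = order+finished≡n
      ; finished-unique = finished-unique
      ; order<ordD = order<ordD
      ; finished-edge = finished-edge
      ; ordD-injective = ordD-injective
      ; between-reachable = between-reachable
      ; finished-visited = λ x∈finished → mark-preserves (finished-visited x∈finished)
      ; visited-finished-or-stacked = finished-or-stacked
      ; stack-not-finished = λ { (here refl) → v∉finished
                               ; (there x∈stack) → stack-not-finished x∈stack }
      ; stack-visited = λ { (here refl) → mark-visits v st
                          ; (there x∈stack) → mark-preserves (stack-visited x∈stack) }
      ; region-after-s = after-s }
      where
        open Invariant I
        v∉finished : v ∉ finished
        v∉finished v∈finished = unvisited⇒¬Visited unvisited (finished-visited v∈finished)

        finished-or-stacked : ∀ {x} → Visited (mark G v st) x → x ∈ finished ⊎ x ∈ v ∷ stack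
        finished-or-stacked isVisited with mark-visited⁻ isVisited
        ... | inj₁ x≡v = inj₂ (here x≡v)
        ... | inj₂ wasVisited with visited-finished-or-stacked wasVisited
        ...   | inj₁ x∈finished = inj₁ x∈finished
        ...   | inj₂ x∈stack    = inj₂ (there x∈stack)

        after-s : ∀ {x} → P x → Visited (mark G v st) x → Visited (mark G v st) s
        after-s Px isVisited with mark-visited⁻ isVisited
        ... | inj₁ refl       = mark-preserves (guard Px)
        ... | inj₂ wasVisited = mark-preserves (region-after-s Px wasVisited)

    -- What Visit(root) (targets = [root]) or a scan of the out-neighbours targets of root achieves.
    record Outcome (stack finished : List (Fin n)) (st : State G)
                   (root : Fin n) (targets : List (Fin n)) (st′ : State G) : Set where
      field
        finished′        : List (Fin n)
        invariant        : Invariant stack finished′ st′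
        targets-finished : targets ⊆ finished′
        finished-grows   : finished ⊆ finished′
        new-from-root    : ∀ {x} → x ∈ finished′ → x ∈ finished ⊎ Walk G root x
        new-ordD≤order   : ∀ {x} → x ∈ finished′ → x ∉ finished → ordD st′ x ≤ order st
        old-ordD-kept    : ∀ {x} → x ∈ finished → ordD st′ x ≡ ordD st x
        order-decreases  : order st′ ≤ order st

    loop-empty : ∀ {stack finished st v} → Invariant stack finished st → Outcome stack finished st v [] st
    loop-empty {finished = finished} I = record
      { finished′ = finished ; invariant = I ; targets-finished = λ ()
      ; finished-grows = λ x∈finished → x∈finished ; new-from-root = inj₁
      ; new-ordD≤order = λ x∈finished x∉finished → ⊥-elim (x∉finished x∈finished)
      ; old-ordD-kept = λ _ → refl ; order-decreases = ≤-refl }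

    -- A visited out-neighbour w of v is already numbered: were it on the stack, w ↝ v → w would be a cycle.
    loop-skip : ∀ {stack finished st v w ws st′} → Invariant (v ∷ stack) finished st → Visited st w →
                All.All (λ x → Walk G x v) (v ∷ stack) → Edge G v w →
                Outcome (v ∷ stack) finished st v ws st′ → Outcome (v ∷ stack) finished st v (w ∷ ws) st′
    loop-skip {w = w} I isVisited reaches e O = record
      { finished′ = finished′ ; invariant = invariant ; targets-finished = targets-finished′
      ; finished-grows = finished-grows ; new-from-root = new-from-root
      ; new-ordD≤order = new-ordD≤order ; old-ordD-kept = old-ordD-kept
      ; order-decreases = order-decreases }
      where
        open Outcome O
        w∈finished′ : w ∈ finished′
        w∈finished′ with Invariant.visited-finished-or-stacked I isVisited
        ... | inj₁ w∈finished = finished-grows w∈finished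
        ... | inj₂ w∈stack    = ⊥-elim (acyclic e (All.lookup reaches w∈stack))

        targets-finished′ : w ∷ _ ⊆ finished′
        targets-finished′ (here refl)  = w∈finished′
        targets-finished′ (there x∈ws) = targets-finished x∈ws

    call-guard : ∀ {stack finished st v w} → Invariant (v ∷ stack) finished st → Edge G v w →
                 P w → Visited st s
    call-guard I e Pw with entered-via-s e Pw
    ... | inj₁ Pv   = Invariant.region-after-s I Pv (Invariant.stack-visited I (here refl))
    ... | inj₂ refl = Invariant.stack-visited I (here refl)

    module Finish {stack finished st v st″} (I : Invariant stack finished st)
                  (unvisited : visited st v ≡ false)
                  (O : Outcome (v ∷ stack) finished (mark G v st) v (adj v) st″) where
      private
        module I = Invariant I
        module O = Outcome O
        module I″ = Invariant O.invariant

      F″ : List (Fin n)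
      F″ = O.finished′

      st′ : State G
      st′ = assign G v st″

      v∉F″ : v ∉ F″
      v∉F″ = I″.stack-not-finished (here refl)

      ordD-kept : ∀ {x} → x ∈ F″ → ordD st′ x ≡ ordD st″ x
      ordD-kept x∈F″ = assign-ordD-other {st = st″} (λ x≡v → v∉F″ (subst (_∈ F″) x≡v x∈F″))

      ordD-v : ordD st′ v ≡ order st″
      ordD-v = assign-ordD-self v st″

      -- v ∷ F″ is a list of distinct vertices, so it is not longer than n = order st″ + length F″.
      order-positive : 0 < order st″
      order-positive = +-cancelʳ-≤ (length F″) 1 (order st″)
        (subst (suc (length F″) ≤_) (sym I″.order+finished≡n)
          (Unique⇒length≤ (¬Any⇒All¬ _ v∉F″ ∷ I″.finished-unique)))

      order′<order : order st′ < order st″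
      order′<order with order st″ | order-positive
      ... | suc o | _ = ≤-refl

      order+finished≡n : order st′ + length (v ∷ F″) ≡ n
      order+finished≡n with order st″ | order-positive | I″.order+finished≡n
      ... | suc o | _ | o+F″≡n = trans (+-suc o (length F″)) o+F″≡n

      order<ordD : ∀ {x} → x ∈ v ∷ F″ → order st′ < ordD st′ x
      order<ordD (here refl)  = subst (order st′ <_) (sym ordD-v) order′<order
      order<ordD (there x∈F″) =
        subst (order st′ <_) (sym (ordD-kept x∈F″)) (<-trans order′<order (I″.order<ordD x∈F″))

      finished-edge : ∀ {u w} → u ∈ v ∷ F″ → Edge G u w → w ∈ v ∷ F″ × ordD st′ u < ordD st′ w
      finished-edge (here refl) e =
        there w∈F″ , subst₂ _<_ (sym ordD-v) (sym (ordD-kept w∈F″)) (I″.order<ordD w∈F″)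
        where
          w∈F″ : _ ∈ F″
          w∈F″ = O.targets-finished e
      finished-edge (there u∈F″) e with I″.finished-edge u∈F″ e
      ... | w∈F″ , u<w = there w∈F″ , subst₂ _<_ (sym (ordD-kept u∈F″)) (sym (ordD-kept w∈F″)) u<w

      ordD-injective : ∀ {x y} → x ∈ v ∷ F″ → y ∈ v ∷ F″ → ordD st′ x ≡ ordD st′ y → x ≡ y
      ordD-injective (here refl)  (here refl)  _ = refl
      ordD-injective (here refl)  (there y∈F″) eq =
        ⊥-elim (<-irrefl (trans (sym ordD-v) (trans eq (ordD-kept y∈F″))) (I″.order<ordD y∈F″))
      ordD-injective (there x∈F″) (here refl)  eq =
        ⊥-elim (<-irrefl (trans (sym ordD-v) (trans (sym eq) (ordD-kept x∈F″))) (I″.order<ordD x∈F″))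
      ordD-injective (there x∈F″) (there y∈F″) eq =
        I″.ordD-injective x∈F″ y∈F″ (trans (sym (ordD-kept x∈F″)) (trans eq (ordD-kept y∈F″)))

      old-above-new : ∀ {x y} → x ∈ finished → y ∈ F″ → y ∉ finished → ordD st′ y < ordD st′ x
      old-above-new x∈finished y∈F″ y∉finished = subst₂ _<_
        (sym (ordD-kept y∈F″)) (sym (trans (ordD-kept x∈F″) (O.old-ordD-kept x∈finished)))
        (≤-<-trans (O.new-ordD≤order y∈F″ y∉finished) (I.order<ordD x∈finished))
        where
          x∈F″ : _ ∈ F″
          x∈F″ = O.finished-grows x∈finished

      module _ (v≡s : v ≡ s) where
        t∈F″ : t ∈ F″
        t∈F″ = leaves-v s↝t
          where
            leaves-v : Walk G s t → t ∈ F″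
            leaves-v []      = ⊥-elim (s≢t refl)
            leaves-v (e ∷ p) =
              finished-closed O.invariant (O.targets-finished (subst (λ x → Edge G x _) (sym v≡s) e)) p

        t∉finished : t ∉ finished
        t∉finished t∈finished = unvisited⇒¬Visited (subst (λ x → visited st x ≡ false) v≡s unvisited)
                                  (I.region-after-s Pt (I.finished-visited t∈finished))

      between-reachable : s ∈ v ∷ F″ → ∀ {y} → y ∈ v ∷ F″ →
                          ordD st′ s < ordD st′ y → ordD st′ y < ordD st′ t → Walk G s y
      between-reachable (here refl) (here refl) s<s _ = ⊥-elim (<-irrefl refl s<s)
      between-reachable (here s≡v) {y} (there y∈F″) _ y<t with O.new-from-root y∈F″
      ... | inj₂ v↝y       = subst (λ x → Walk G x y) (sym s≡v) v↝y
      ... | inj₁ y∈finished =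
        ⊥-elim (<-asym y<t (old-above-new y∈finished (t∈F″ (sym s≡v)) (t∉finished (sym s≡v))))
      between-reachable (there s∈F″) (here refl) s<v _ =
        ⊥-elim (<-asym s<v (subst₂ _<_ (sym ordD-v) (sym (ordD-kept s∈F″)) (I″.order<ordD s∈F″)))
      between-reachable (there s∈F″) (there y∈F″) s<y y<t =
        I″.between-reachable s∈F″ y∈F″
          (subst₂ _<_ (ordD-kept s∈F″) (ordD-kept y∈F″) s<y)
          (subst₂ _<_ (ordD-kept y∈F″) (ordD-kept (finished-closed O.invariant s∈F″ s↝t)) y<t)

      invariant : Invariant stack (v ∷ F″) st′
      invariant = record
        { order+finished≡n = order+finished≡n
        ; finished-unique = ¬Any⇒All¬ _ v∉F″ ∷ I″.finished-unique
        ; finished-visited = λ { (here refl) → assign-Visited (I″.stack-visited (here refl))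
                               ; (there x∈F″) → assign-Visited (I″.finished-visited x∈F″) }
        ; order<ordD = order<ordD
        ; visited-finished-or-stacked = finished-or-stacked
        ; stack-not-finished = stack-not-finished
        ; stack-visited = λ x∈stack → assign-Visited (I″.stack-visited (there x∈stack))
        ; finished-edge = finished-edge
        ; ordD-injective = ordD-injective
        ; region-after-s = λ Px → assign-Visited ∘ I″.region-after-s Px ∘ assign-Visited⁻
        ; between-reachable = between-reachable }
        where
          finished-or-stacked : ∀ {x} → Visited st′ x → x ∈ v ∷ F″ ⊎ x ∈ stack
          finished-or-stacked isVisited with I″.visited-finished-or-stacked (assign-Visited⁻ isVisited)
          ... | inj₁ x∈F″            = inj₁ (there x∈F″)
          ... | inj₂ (here x≡v)      = inj₁ (here x≡v)
          ... | inj₂ (there x∈stack) = inj₂ x∈stack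

          stack-not-finished : ∀ {x} → x ∈ stack → x ∉ v ∷ F″
          stack-not-finished x∈stack (here refl)  = unvisited⇒¬Visited unvisited (I.stack-visited x∈stack)
          stack-not-finished x∈stack (there x∈F″) = I″.stack-not-finished (there x∈stack) x∈F″

      outcome : Outcome stack finished st v (v ∷ []) st′
      outcome = record
        { finished′ = v ∷ F″
        ; invariant = invariant
        ; targets-finished = λ { (here refl) → here refl }
        ; finished-grows = λ x∈finished → there (O.finished-grows x∈finished)
        ; new-from-root = λ { (here refl) → inj₂ [] ; (there x∈F″) → O.new-from-root x∈F″ }
        ; new-ordD≤order = λ { (here refl) _ → subst (_≤ order st) (sym ordD-v) O.order-decreases
                             ; (there x∈F″) x∉finished → subst (_≤ order st) (sym (ordD-kept x∈F″))
                                                             (O.new-ordD≤order x∈F″ x∉finished) }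
        ; old-ordD-kept = λ x∈finished →
            trans (ordD-kept (O.finished-grows x∈finished)) (O.old-ordD-kept x∈finished)
        ; order-decreases = ≤-trans (m∸n≤m (order st″) 1) O.order-decreases }

    loop-call : ∀ {stack finished st v w ws st₁ st′} → Edge G v w →
                (W : Outcome (v ∷ stack) finished st w (w ∷ []) st₁) →
                Outcome (v ∷ stack) (Outcome.finished′ W) st₁ v ws st′ →
                Outcome (v ∷ stack) finished st v (w ∷ ws) st′
    loop-call {finished = finished} {st} {v} {st′ = st′} e W R = record
      { finished′ = R.finished′
      ; invariant = R.invariant
      ; targets-finished = λ { (here refl) → R.finished-grows (W.targets-finished (here refl))
                             ; (there x∈ws) → R.targets-finished x∈ws }
      ; finished-grows = λ x∈finished → R.finished-grows (W.finished-grows x∈finished)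
      ; new-from-root = new-from-root
      ; new-ordD≤order = new-ordD≤order
      ; old-ordD-kept = λ x∈finished →
          trans (R.old-ordD-kept (W.finished-grows x∈finished)) (W.old-ordD-kept x∈finished)
      ; order-decreases = ≤-trans R.order-decreases W.order-decreases }
      where
        module W = Outcome W
        module R = Outcome R

        new-from-root : ∀ {x} → x ∈ R.finished′ → x ∈ finished ⊎ Walk G v x
        new-from-root x∈R with R.new-from-root x∈R
        ... | inj₂ v↝x = inj₂ v↝x
        ... | inj₁ x∈W with W.new-from-root x∈W
        ...   | inj₁ x∈finished = inj₁ x∈finished
        ...   | inj₂ w↝x       = inj₂ (e ∷ w↝x)

        new-ordD≤order : ∀ {x} → x ∈ R.finished′ → x ∉ finished → ordD st′ x ≤ order st
        new-ordD≤order {x} x∈R x∉finished with x ∈? W.finished′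
        ... | yes x∈W =
          subst (_≤ order st) (sym (R.old-ordD-kept x∈W)) (W.new-ordD≤order x∈W x∉finished)
        ... | no x∉W  = ≤-trans (R.new-ordD≤order x∈R x∉W) W.order-decreases

    mutual
      visit-outcome : ∀ {stack finished st v st′} → Visit G st v st′ → Invariant stack finished st →
                      visited st v ≡ false → All.All (λ x → Walk G x v) stack → (P v → Visited st s) →
                      Outcome stack finished st v (v ∷ []) st′
      visit-outcome (visit loop) I unvisited reaches guard =
        Finish.outcome I unvisited
          (loop-outcome loop (start-invariant I unvisited guard) ([] All.∷ reaches) (λ w∈adj → w∈adj))

      loop-outcome : ∀ {stack finished st v ws st′} → VisitAll G st ws st′ →
                     Invariant (v ∷ stack) finished st → All.All (λ x → Walk G x v) (v ∷ stack) →
                     ws ⊆ adj v → Outcome (v ∷ stack) finished st v ws st′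
      loop-outcome done I reaches ws⊆adj = loop-empty I
      loop-outcome (skip isVisited loop) I reaches ws⊆adj =
        loop-skip I (visited✓ isVisited) reaches (ws⊆adj (here refl))
          (loop-outcome loop I reaches (λ w∈ws → ws⊆adj (there w∈ws)))
      loop-outcome (call unvisited visit-w loop) I reaches ws⊆adj =
        loop-call e W (loop-outcome loop (Outcome.invariant W) reaches (λ w∈ws → ws⊆adj (there w∈ws)))
        where
          e : Edge G _ _
          e = ws⊆adj (here refl)
          W : Outcome _ _ _ _ (_ ∷ []) _
          W = visit-outcome visit-w I unvisited (All.map (_▷ e) reaches) (call-guard I e)

    search-numbering : ∀ {src st} → Visit G (initState G) src st → ¬ P src → (∀ y → Walk G src y) →
                       SeparatingNumbering G s t (ordD st)
    search-numbering {src} {st} run src∉P src↝ = record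
      { edge-increasing = λ e → proj₂ (finished-edge (everything-finished _) e)
      ; injective = λ eq → ordD-injective (everything-finished _) (everything-finished _) eq
      ; between-reachable = between-reachable (everything-finished s) (everything-finished _) }
      where
        O : Outcome [] [] (initState G) src (src ∷ []) st
        O = visit-outcome run initial-invariant refl All.[] (⊥-elim ∘ src∉P)
        open Outcome O using (invariant; targets-finished)
        open Invariant invariant

        everything-finished : ∀ x → x ∈ Outcome.finished′ O
        everything-finished x = finished-closed invariant (targets-finished (here refl)) (src↝ x)

lemma4 : (G : Graph) → Acyclic G →
         (src snk : Fin (Graph.n G)) →
         IsSource G src → (∀ v → IsSource G v → v ≡ src) →
         IsSink G snk → (∀ v → IsSink G v → v ≡ snk) →
         (s t : Fin (Graph.n G)) → Superbubble G s t →
         (ordD : Fin (Graph.n G) → ℕ) → TopologicalSort G src ordD →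
         (∀ x → InU G s t x → x ≢ s → x ≢ t → (ordD s < ordD x) × (ordD x < ordD t))
         × (∀ y → ¬ InU G s t y → (ordD y < ordD s) ⊎ (ordD t < ordD y))
lemma4 G acyclic src _ src-source src-unique _ _ s t (candidate , _) ._ (st , run , refl) =
  interior-between numbering , exterior-outside numbering
  where
    open Superbubbles G acyclic candidate
    open DepthFirstSearch.Region G acyclic s t InU∖s U∖s-entered-via-s t∈U∖s s≢t s↝t

    numbering : SeparatingNumbering G s t (State.ordD st)
    numbering = search-numbering run (source∉U∖s src-source)
                  (Walks.unique-source-reaches G acyclic src src-unique)
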